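{- (i) The map $\mathrm{inv}:\mathcal{H}_{\ast}\to\mathcal{H}_{\ast}$ is an anti-morphism of stuffle algebras: $\mathrm{inv}(u\ast v)=\mathrm{inv}(v)\ast\mathrm{inv}(u)$ for all $u,v\in\mathcal{H}_{\ast}$. (ii) The map $\imath_{\ast,T}:\mathcal{H}_{\ast}\to\mathcal{H}_{\ast}[[T]]$ is a morphism of stuffle algebras: $\imath_{\ast,T}(u\ast v)=\imath_{\ast,T}(u)\ast\imath_{\ast,T}(v)$ for all $u,v\in\mathcal{H}_{\ast}$.
   Context: $\mathcal{H}_{\ast}$ is the free algebra on letters $y_s$ ($s\geq1$), $y_0:=1$, with stuffle product $\ast$: $1\ast w=w\ast1=w$, $y_sw_1\ast y_{s'}w_2=y_s(w_1\ast y_{s'}w_2)+y_{s'}(y_sw_1\ast w_2)+y_{s+s'}(w_1\ast w_2)$, extended $T$-bilinearly to $\mathcal{H}_{\ast}[[T]]$. $\mathrm{inv}$ is the unique anti-morphism of concatenation algebras with $\mathrm{inv}(y_n)=(-1)^ny_n$. $\imath_{\ast,T}$ is the unique morphism of concatenation algebras with $\imath_{\ast,T}(y_s)=\sum_{l\geq0}(-T)^l\binom{l+s-1}{l}y_{s+l}$. -}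

module Defs where

open import Data.Nat as ℕ using (ℕ; zero; suc)
open import Data.Nat.Combinatorics using (_C_)
open import Data.Integer using (+_)
open import Data.Rational as ℚ using (ℚ; 0ℚ; 1ℚ; _/_)
open import Data.List using (List; []; _∷_; _++_; map; concat; concatMap; reverse; upTo; foldr)
open import Data.List.Properties using (≡-dec)
open import Data.Product using (_×_; _,_)
open import Relation.Nullary using (yes; no)
open import Relation.Binary.PropositionalEquality using (_≡_)

-- Letters y_s (s ≥ 1) are encoded by ℕ: the entry k stands for y_(k+1).
Letter : Set
Letter = ℕ

index : Letter → ℕ
index k = suc k

Word : Set
Word = List Letter

-- Elements of H_* (coefficients in ℚ): finite formal ℚ-linear combinations of words.
H : Set
H = List (ℚ × Word)

coeff : H → Word → ℚ
coeff [] w = 0ℚ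
coeff ((c , u) ∷ p) w with ≡-dec ℕ._≟_ u w
... | yes _ = c ℚ.+ coeff p w
... | no  _ = coeff p w

infix 4 _≈ᴴ_
_≈ᴴ_ : H → H → Set
p ≈ᴴ q = ∀ w → coeff p w ≡ coeff q w

ℕtoℚ : ℕ → ℚ
ℕtoℚ n = + n / 1

scale : ℚ → H → H
scale c = map (λ { (d , w) → (c ℚ.* d , w) })

prepend : Letter → H → H
prepend a = map (λ { (d , w) → (d , a ∷ w) })

-- stuffle product of words; merging y_s and y_s' gives y_(s+s'),
-- i.e. codes a, b merge to code suc (a + b).
stuffleW : Word → Word → H
stuffleW [] v = (1ℚ , v) ∷ []
stuffleW (a ∷ u) [] = (1ℚ , a ∷ u) ∷ []
stuffleW (a ∷ u) (b ∷ v) =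
  prepend a (stuffleW u (b ∷ v)) ++
  (prepend b (stuffleW (a ∷ u) v) ++
   prepend (suc (a ℕ.+ b)) (stuffleW u v))

infixl 7 _∗_
_∗_ : H → H → H
p ∗ q = concatMap (λ { (c , u) → concatMap (λ { (d , v) → scale (c ℚ.* d) (stuffleW u v) }) q }) p

sgn : ℕ → ℚ
sgn zero = 1ℚ
sgn (suc n) = ℚ.- (sgn n)

-- inv : anti-morphism of concatenation with inv(y_n) = (-1)^n y_n
invW : Word → ℚ × Word
invW w = (sgn (foldr (λ k acc → index k ℕ.+ acc) 0 w) , reverse w)

inv : H → H
inv = map (λ { (c , w) → let (e , w′) = invW w in (c ℚ.* e , w′) })

-- Elements of H_*[[T]] : the sequence of coefficients of T^n (each in H_*).
HT : Set
HT = ℕ → H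

-- concatenation-morphism ι_{*,T}, on words: coefficient of T^n in
-- ι(y_{s_1}) ⋯ ι(y_{s_k}), where ι(y_s) = Σ_l (-T)^l binom(l+s-1,l) y_{s+l}.
-- For code k (s = k+1): binom(l+s-1,l) = binom(l+k,l) and y_{s+l} has code k+l.
ιW : Word → ℕ → H
ιW [] zero = (1ℚ , []) ∷ []
ιW [] (suc n) = []
ιW (k ∷ w) n =
  concatMap (λ l → scale (sgn l ℚ.* ℕtoℚ ((l ℕ.+ k) C l)) (prepend (k ℕ.+ l) (ιW w (n ℕ.∸ l))))
            (upTo (suc n))

ι : H → HT
ι p n = concatMap (λ { (c , w) → scale c (ιW w n) }) p

infixl 7 _∗ₜ_
_∗ₜ_ : HT → HT → HT
(f ∗ₜ g) n = concatMap (λ i → f i ∗ g (n ℕ.∸ i)) (upTo (suc n))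

infix 4 _≈ᵀ_
_≈ᵀ_ : HT → HT → Set
f ≈ᵀ g = ∀ n → f n ≈ᴴ g n

module Submission where

-- Elements of H_* are compared through their pairings
-- ⟨ p ∣ f ⟩ = Σ c·f(w) with arbitrary functions f on words: p ≈ᴴ q as soon
-- as all pairings agree (≈ᴴ-byPairing), and pairing turns the products ∗, ∗ₜ
-- and the linear maps inv, ι into iterated pairings over single words
-- (⟨⟩-∗, ⟨⟩-inv, ⟨⟩-ι, ⟨⟩-ι∗ₜι).  Both statements thereby reduce to identities
-- in ℚ for two words u, v, proved by induction along the stuffle recursion:
--  (i)  inv(u ⋆ v) = inv v ⋆ inv u (⋆-inv) combines three properties of the
--       stuffle of words: it is commutative, it obeys the mirror recursion on
--       last letters and so commutes with reversal (⋆-reverse), and it is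
--       homogeneous for the weight, so the sign (-1)^weight factors (⋆-sign).
--  (ii) ι(u ⋆ v) = ι u ∗ₜ ι v (ι-⋆): ι is the concatenation morphism of the
--       letter substitution y_s ↦ Σ_l (-T)^l binom(l+s-1,l) y_(s+l); expanding
--       the first letters of u and v reproduces the three terms of the stuffle
--       recursion, the merged term by Vandermonde's identity (coefficient-merge).

open import Defs
open import Data.Nat as ℕ using (ℕ; zero; suc)
import Data.Nat.Properties as ℕP
import Data.Rational.Properties as ℚP
open import Data.Rational as ℚ using (ℚ; 0ℚ; 1ℚ; _+_; _*_; -_; mkℚ)
open import Data.Integer as ℤ using ()
import Data.Integer.Properties as ℤP
open import Data.Nat.Coprimality using (Coprime; 1-coprimeTo)
import Data.Nat.Coprimality as Coprimality
open import Data.Nat.Combinatorics using (_C_; nCk+nC[k+1]≡[n+1]C[k+1]; nCn≡1)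
open import Data.List using ([]; _∷_; _++_; _∷ʳ_; reverse; foldr; concatMap; applyUpTo; upTo)
open import Data.List.Properties using (≡-dec; unfold-reverse)
open import Function using (_∘_)
open import Data.Product using (_×_; _,_)
open import Relation.Nullary using (yes; no)
open import Relation.Binary.PropositionalEquality
open import Tactic.RingSolver using (solve-∀)
open import Tactic.RingSolver.Core.AlmostCommutativeRing using (AlmostCommutativeRing; fromCommutativeRing)
open import Level using (0ℓ)
open import Data.Maybe using (nothing)
open import Algebra.Bundles using (CommutativeMonoid)
import Algebra.Properties.CommutativeSemigroup as CommutativeSemigroupProperties
open import Data.Nat.Tactic.RingSolver using () renaming (solve-∀ to solve-∀-ℕ)

open ≡-Reasoning

ℚ-ring : AlmostCommutativeRing 0ℓ 0ℓ
ℚ-ring = fromCommutativeRing ℚP.+-*-commutativeRing (λ _ → nothing)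

module +-Props = CommutativeSemigroupProperties (CommutativeMonoid.commutativeSemigroup ℚP.+-0-commutativeMonoid)
module *-Props = CommutativeSemigroupProperties (CommutativeMonoid.commutativeSemigroup ℚP.*-1-commutativeMonoid)

-- Two elements are equal iff all their pairings agree (see ≈ᴴ-byPairing),
-- so every identity in H_* becomes an identity in ℚ.
infix 4 ⟨_∣_⟩
⟨_∣_⟩ : H → (Word → ℚ) → ℚ
⟨ [] ∣ f ⟩ = 0ℚ
⟨ (c , w) ∷ p ∣ f ⟩ = c * f w + ⟨ p ∣ f ⟩

⟨⟩-++ : ∀ p q f → ⟨ p ++ q ∣ f ⟩ ≡ ⟨ p ∣ f ⟩ + ⟨ q ∣ f ⟩
⟨⟩-++ [] q f = sym (ℚP.+-identityˡ _)
⟨⟩-++ ((c , w) ∷ p) q f =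
  trans (cong (c * f w +_) (⟨⟩-++ p q f)) (sym (ℚP.+-assoc (c * f w) ⟨ p ∣ f ⟩ ⟨ q ∣ f ⟩))

⟨⟩-scale : ∀ c p f → ⟨ scale c p ∣ f ⟩ ≡ c * ⟨ p ∣ f ⟩
⟨⟩-scale c [] f = sym (ℚP.*-zeroʳ c)
⟨⟩-scale c ((d , w) ∷ p) f = trans (cong (c * d * f w +_) (⟨⟩-scale c p f)) (distrib c d (f w) _)
  where
  distrib : ∀ (c d x y : ℚ) → c * d * x + c * y ≡ c * (d * x + y)
  distrib = solve-∀ ℚ-ring

⟨⟩-prepend : ∀ a p f → ⟨ prepend a p ∣ f ⟩ ≡ ⟨ p ∣ (λ w → f (a ∷ w)) ⟩
⟨⟩-prepend a [] f = refl
⟨⟩-prepend a ((d , w) ∷ p) f = cong (d * f (a ∷ w) +_) (⟨⟩-prepend a p f)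

⟨⟩-cong : ∀ p {f g} → (∀ w → f w ≡ g w) → ⟨ p ∣ f ⟩ ≡ ⟨ p ∣ g ⟩
⟨⟩-cong [] e = refl
⟨⟩-cong ((c , w) ∷ p) e = cong₂ (λ x y → c * x + y) (e w) (⟨⟩-cong p e)

⟨⟩-+ : ∀ p f g → ⟨ p ∣ (λ w → f w + g w) ⟩ ≡ ⟨ p ∣ f ⟩ + ⟨ p ∣ g ⟩
⟨⟩-+ [] f g = refl
⟨⟩-+ ((c , w) ∷ p) f g = trans (cong (c * (f w + g w) +_) (⟨⟩-+ p f g)) (rearrange c (f w) (g w) _ _)
  where
  rearrange : ∀ (c x y s t : ℚ) → c * (x + y) + (s + t) ≡ (c * x + s) + (c * y + t)
  rearrange = solve-∀ ℚ-ring

⟨⟩-* : ∀ p c f → ⟨ p ∣ (λ w → c * f w) ⟩ ≡ c * ⟨ p ∣ f ⟩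
⟨⟩-* [] c f = sym (ℚP.*-zeroʳ c)
⟨⟩-* ((d , w) ∷ p) c f = trans (cong (d * (c * f w) +_) (⟨⟩-* p c f)) (rearrange d c (f w) _)
  where
  rearrange : ∀ (d c x s : ℚ) → d * (c * x) + c * s ≡ c * (d * x + s)
  rearrange = solve-∀ ℚ-ring

⟨⟩-0 : ∀ p → ⟨ p ∣ (λ _ → 0ℚ) ⟩ ≡ 0ℚ
⟨⟩-0 p = trans (⟨⟩-cong p (λ _ → sym (ℚP.*-zeroˡ 0ℚ))) (trans (⟨⟩-* p 0ℚ (λ _ → 0ℚ)) (ℚP.*-zeroˡ ⟨ p ∣ (λ _ → 0ℚ) ⟩))

⟨⟩-swap : ∀ p q (g : Word → Word → ℚ) →
  ⟨ p ∣ (λ u → ⟨ q ∣ (λ v → g u v) ⟩) ⟩ ≡ ⟨ q ∣ (λ v → ⟨ p ∣ (λ u → g u v) ⟩) ⟩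
⟨⟩-swap [] q g = sym (⟨⟩-0 q)
⟨⟩-swap ((c , w) ∷ p) q g = begin
  c * ⟨ q ∣ g w ⟩ + ⟨ p ∣ (λ u → ⟨ q ∣ g u ⟩) ⟩
    ≡⟨ cong₂ _+_ (sym (⟨⟩-* q c (g w))) (⟨⟩-swap p q g) ⟩
  ⟨ q ∣ (λ v → c * g w v) ⟩ + ⟨ q ∣ (λ v → ⟨ p ∣ (λ u → g u v) ⟩) ⟩
    ≡⟨ ⟨⟩-+ q (λ v → c * g w v) (λ v → ⟨ p ∣ (λ u → g u v) ⟩) ⟨
  ⟨ q ∣ (λ v → c * g w v + ⟨ p ∣ (λ u → g u v) ⟩) ⟩ ∎

δ : Word → Word → ℚ
δ w u = coeff ((1ℚ , u) ∷ []) w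

coeff-pairing : ∀ p w → coeff p w ≡ ⟨ p ∣ δ w ⟩
coeff-pairing [] w = refl
coeff-pairing ((c , u) ∷ p) w with ≡-dec ℕ._≟_ u w
... | yes _ = cong₂ _+_ (sym (trans (cong (c *_) (ℚP.+-identityʳ 1ℚ)) (ℚP.*-identityʳ c))) (coeff-pairing p w)
... | no _ = trans (coeff-pairing p w) (sym (trans (cong (_+ ⟨ p ∣ δ w ⟩) (ℚP.*-zeroʳ c)) (ℚP.+-identityˡ _)))

≈ᴴ-byPairing : ∀ p q → (∀ f → ⟨ p ∣ f ⟩ ≡ ⟨ q ∣ f ⟩) → p ≈ᴴ q
≈ᴴ-byPairing p q e w = trans (coeff-pairing p w) (trans (e (δ w)) (sym (coeff-pairing q w)))

⟨⟩-linearExtension : ∀ (G : ℚ × Word → H) (h : Word → ℚ) p f →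
  (∀ c w → ⟨ G (c , w) ∣ f ⟩ ≡ c * h w) → ⟨ concatMap G p ∣ f ⟩ ≡ ⟨ p ∣ h ⟩
⟨⟩-linearExtension G h [] f e = refl
⟨⟩-linearExtension G h ((c , w) ∷ p) f e =
  trans (⟨⟩-++ (G (c , w)) (concatMap G p) f) (cong₂ _+_ (e c w) (⟨⟩-linearExtension G h p f e))

Σ< : ℕ → (ℕ → ℚ) → ℚ
Σ< zero g = 0ℚ
Σ< (suc k) g = g 0 + Σ< k (λ i → g (suc i))

⟨⟩-concatMap-upTo : ∀ (G : ℕ → H) k f → ⟨ concatMap G (upTo k) ∣ f ⟩ ≡ Σ< k (λ i → ⟨ G i ∣ f ⟩)
⟨⟩-concatMap-upTo G k f = reindexed (λ i → i) k
  where
  reindexed : ∀ φ m → ⟨ concatMap G (applyUpTo φ m) ∣ f ⟩ ≡ Σ< m (λ i → ⟨ G (φ i) ∣ f ⟩)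
  reindexed φ zero = refl
  reindexed φ (suc m) =
    trans (⟨⟩-++ (G (φ 0)) _ f) (cong (⟨ G (φ 0) ∣ f ⟩ +_) (reindexed (λ i → φ (suc i)) m))

Σ<-cong : ∀ k {f g} → (∀ i → f i ≡ g i) → Σ< k f ≡ Σ< k g
Σ<-cong zero e = refl
Σ<-cong (suc k) e = cong₂ _+_ (e 0) (Σ<-cong k (λ i → e (suc i)))

Σ<-+ : ∀ k f g → Σ< k (λ i → f i + g i) ≡ Σ< k f + Σ< k g
Σ<-+ zero f g = refl
Σ<-+ (suc k) f g = trans (cong (f 0 + g 0 +_) (Σ<-+ k (λ i → f (suc i)) (λ i → g (suc i))))
                         (+-Props.interchange (f 0) (g 0) (Σ< k (λ i → f (suc i))) (Σ< k (λ i → g (suc i))))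

Σ<-* : ∀ k c f → Σ< k (λ i → c * f i) ≡ c * Σ< k f
Σ<-* zero c f = sym (ℚP.*-zeroʳ c)
Σ<-* (suc k) c f =
  trans (cong (c * f 0 +_) (Σ<-* k c (λ i → f (suc i)))) (sym (ℚP.*-distribˡ-+ c (f 0) _))

Σ<-0 : ∀ k → Σ< k (λ _ → 0ℚ) ≡ 0ℚ
Σ<-0 zero = refl
Σ<-0 (suc k) = cong (0ℚ +_) (Σ<-0 k)

⟨⟩-Σ< : ∀ p k (g : ℕ → Word → ℚ) → ⟨ p ∣ (λ w → Σ< k (λ i → g i w)) ⟩ ≡ Σ< k (λ i → ⟨ p ∣ g i ⟩)
⟨⟩-Σ< p zero g = ⟨⟩-0 p
⟨⟩-Σ< p (suc k) g =
  trans (⟨⟩-+ p (g 0) (λ w → Σ< k (λ i → g (suc i) w))) (cong (⟨ p ∣ g 0 ⟩ +_) (⟨⟩-Σ< p k (λ i → g (suc i))))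

-- Sums over the decompositions n = i + j, i.e. the Cauchy product of
-- power series in T: Σ₂ n h = Σ_{i+j=n} h i j.
Σ₂ : ℕ → (ℕ → ℕ → ℚ) → ℚ
Σ₂ n h = Σ< (suc n) (λ i → h i (n ℕ.∸ i))

Σ₂-cong : ∀ n {g h : ℕ → ℕ → ℚ} → (∀ i j → g i j ≡ h i j) → Σ₂ n g ≡ Σ₂ n h
Σ₂-cong n e = Σ<-cong (suc n) (λ i → e i (n ℕ.∸ i))

Σ₂-cong-diag : ∀ n {g h : ℕ → ℕ → ℚ} → (∀ i j → i ℕ.+ j ≡ n → g i j ≡ h i j) → Σ₂ n g ≡ Σ₂ n h
Σ₂-cong-diag zero e = cong (_+ 0ℚ) (e 0 0 refl)
Σ₂-cong-diag (suc n) e =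
  cong₂ _+_ (e 0 (suc n) refl) (Σ₂-cong-diag n (λ i j p → e (suc i) j (cong suc p)))

Σ₂-+ : ∀ n (g h : ℕ → ℕ → ℚ) → Σ₂ n (λ i j → g i j + h i j) ≡ Σ₂ n g + Σ₂ n h
Σ₂-+ n g h = Σ<-+ (suc n) (λ i → g i (n ℕ.∸ i)) (λ i → h i (n ℕ.∸ i))

Σ₂-* : ∀ n c (h : ℕ → ℕ → ℚ) → Σ₂ n (λ i j → c * h i j) ≡ c * Σ₂ n h
Σ₂-* n c h = Σ<-* (suc n) c (λ i → h i (n ℕ.∸ i))

⟨⟩-Σ₂ : ∀ p n (g : ℕ → ℕ → Word → ℚ) → ⟨ p ∣ (λ w → Σ₂ n (λ i j → g i j w)) ⟩ ≡ Σ₂ n (λ i j → ⟨ p ∣ g i j ⟩)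
⟨⟩-Σ₂ p n g = ⟨⟩-Σ< p (suc n) (λ i → g i (n ℕ.∸ i))

Σ₂-first : ∀ n (h : ℕ → ℕ → ℚ) → (∀ i j → h (suc i) j ≡ 0ℚ) → Σ₂ n h ≡ h 0 n
Σ₂-first n h e = trans (cong (h 0 n +_) (trans (Σ<-cong n (λ i → e i _)) (Σ<-0 n))) (ℚP.+-identityʳ (h 0 n))

Σ₂-last : ∀ n (h : ℕ → ℕ → ℚ) → Σ₂ (suc n) h ≡ Σ₂ n (λ i j → h i (suc j)) + h (suc n) 0
Σ₂-last zero h = rearrange (h 0 1) (h 1 0)
  where
  rearrange : ∀ (x y : ℚ) → x + (y + 0ℚ) ≡ (x + 0ℚ) + y
  rearrange x y = trans (cong (x +_) (ℚP.+-identityʳ y)) (cong (_+ y) (sym (ℚP.+-identityʳ x)))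
Σ₂-last (suc n) h =
  trans (cong (h 0 (suc (suc n)) +_) (Σ₂-last n (λ i j → h (suc i) j)))
        (sym (ℚP.+-assoc (h 0 (suc (suc n))) (Σ₂ n (λ i j → h (suc i) (suc j))) (h (suc (suc n)) 0)))

Σ₂-comm : ∀ n (h : ℕ → ℕ → ℚ) → Σ₂ n h ≡ Σ₂ n (λ i j → h j i)
Σ₂-comm zero h = refl
Σ₂-comm (suc n) h = begin
  h 0 (suc n) + Σ₂ n (λ i j → h (suc i) j)   ≡⟨ cong (h 0 (suc n) +_) (Σ₂-comm n (λ i j → h (suc i) j)) ⟩
  h 0 (suc n) + Σ₂ n (λ i j → h (suc j) i)   ≡⟨ ℚP.+-comm (h 0 (suc n)) _ ⟩
  Σ₂ n (λ i j → h (suc j) i) + h 0 (suc n)   ≡⟨ Σ₂-last n (λ i j → h j i) ⟨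
  Σ₂ (suc n) (λ i j → h j i)                 ∎

Σ₂-assoc : ∀ n (h : ℕ → ℕ → ℕ → ℚ) →
  Σ₂ n (λ i r → Σ₂ i (λ l j → h l j r)) ≡ Σ₂ n (λ l s → Σ₂ s (λ j r → h l j r))
Σ₂-assoc zero h = refl
Σ₂-assoc (suc n) h = begin
  (h 0 0 (suc n) + 0ℚ) + Σ₂ n (λ i r → h 0 (suc i) r + Σ₂ i (λ l j → h (suc l) j r))
    ≡⟨ cong ((h 0 0 (suc n) + 0ℚ) +_) (Σ₂-+ n (λ i r → h 0 (suc i) r) (λ i r → Σ₂ i (λ l j → h (suc l) j r))) ⟩
  (h 0 0 (suc n) + 0ℚ) + (Σ₂ n (λ i r → h 0 (suc i) r) + Σ₂ n (λ i r → Σ₂ i (λ l j → h (suc l) j r)))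
    ≡⟨ cong (λ t → (h 0 0 (suc n) + 0ℚ) + (Σ₂ n (λ i r → h 0 (suc i) r) + t)) (Σ₂-assoc n (λ l → h (suc l))) ⟩
  (h 0 0 (suc n) + 0ℚ) + (Σ₂ n (λ i r → h 0 (suc i) r) + Σ₂ n (λ l s → Σ₂ s (λ j r → h (suc l) j r)))
    ≡⟨ rearrange (h 0 0 (suc n)) (Σ₂ n (λ i r → h 0 (suc i) r)) _ ⟩
  (h 0 0 (suc n) + Σ₂ n (λ i r → h 0 (suc i) r)) + Σ₂ n (λ l s → Σ₂ s (λ j r → h (suc l) j r)) ∎
  where
  rearrange : ∀ (x y z : ℚ) → (x + 0ℚ) + (y + z) ≡ (x + y) + z
  rearrange x y z = trans (cong (_+ (y + z)) (ℚP.+-identityʳ x)) (sym (ℚP.+-assoc x y z))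

Σ₂-exchange : ∀ n (h : ℕ → ℕ → ℕ → ℚ) →
  Σ₂ n (λ l s → Σ₂ s (λ m k → h l m k)) ≡ Σ₂ n (λ m s → Σ₂ s (λ l k → h l m k))
Σ₂-exchange n h = begin
  Σ₂ n (λ l s → Σ₂ s (λ m k → h l m k))   ≡⟨ Σ₂-assoc n h ⟨
  Σ₂ n (λ q k → Σ₂ q (λ l m → h l m k))   ≡⟨ Σ₂-cong n (λ q k → Σ₂-comm q (λ l m → h l m k)) ⟩
  Σ₂ n (λ q k → Σ₂ q (λ m l → h l m k))   ≡⟨ Σ₂-assoc n (λ m l k → h l m k) ⟩
  Σ₂ n (λ m s → Σ₂ s (λ l k → h l m k))   ∎

infix 4 ⟨_⋆_∣_⟩
⟨_⋆_∣_⟩ : Word → Word → (Word → ℚ) → ℚ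
⟨ u ⋆ v ∣ f ⟩ = ⟨ stuffleW u v ∣ f ⟩

infixl 7 _⊕_
_⊕_ : Letter → Letter → Letter
a ⊕ b = suc (a ℕ.+ b)

⋆-nilˡ : ∀ v f → ⟨ [] ⋆ v ∣ f ⟩ ≡ f v
⋆-nilˡ v f = trans (ℚP.+-identityʳ _) (ℚP.*-identityˡ (f v))

⋆-nilʳ : ∀ u f → ⟨ u ⋆ [] ∣ f ⟩ ≡ f u
⋆-nilʳ [] f = ⋆-nilˡ [] f
⋆-nilʳ (a ∷ u) f = trans (ℚP.+-identityʳ _) (ℚP.*-identityˡ (f (a ∷ u)))

⋆-cons : ∀ a u b v f → ⟨ (a ∷ u) ⋆ (b ∷ v) ∣ f ⟩ ≡
  ⟨ u ⋆ (b ∷ v) ∣ f ∘ (a ∷_) ⟩ + (⟨ (a ∷ u) ⋆ v ∣ f ∘ (b ∷_) ⟩ + ⟨ u ⋆ v ∣ f ∘ (a ⊕ b ∷_) ⟩)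
⋆-cons a u b v f =
  trans (⟨⟩-++ (prepend a (stuffleW u (b ∷ v))) _ f)
  (cong₂ _+_ (⟨⟩-prepend a (stuffleW u (b ∷ v)) f)
    (trans (⟨⟩-++ (prepend b (stuffleW (a ∷ u) v)) _ f)
      (cong₂ _+_ (⟨⟩-prepend b (stuffleW (a ∷ u) v) f) (⟨⟩-prepend (a ⊕ b) (stuffleW u v) f))))

⋆-comm : ∀ u v f → ⟨ u ⋆ v ∣ f ⟩ ≡ ⟨ v ⋆ u ∣ f ⟩
⋆-comm [] [] f = refl
⋆-comm [] (b ∷ v) f = refl
⋆-comm (a ∷ u) [] f = refl
⋆-comm (a ∷ u) (b ∷ v) f = begin
  ⟨ (a ∷ u) ⋆ (b ∷ v) ∣ f ⟩                          ≡⟨ ⋆-cons a u b v f ⟩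
  ⟨ u ⋆ (b ∷ v) ∣ f ∘ (a ∷_) ⟩ + (⟨ (a ∷ u) ⋆ v ∣ f ∘ (b ∷_) ⟩ + merged)
    ≡⟨ cong₂ (λ x y → x + (y + merged)) (⋆-comm u (b ∷ v) _) (⋆-comm (a ∷ u) v _) ⟩
  ⟨ (b ∷ v) ⋆ u ∣ f ∘ (a ∷_) ⟩ + (⟨ v ⋆ (a ∷ u) ∣ f ∘ (b ∷_) ⟩ + merged)
    ≡⟨ +-Props.x∙yz≈y∙xz ⟨ (b ∷ v) ⋆ u ∣ f ∘ (a ∷_) ⟩ ⟨ v ⋆ (a ∷ u) ∣ f ∘ (b ∷_) ⟩ merged ⟩
  ⟨ v ⋆ (a ∷ u) ∣ f ∘ (b ∷_) ⟩ + (⟨ (b ∷ v) ⋆ u ∣ f ∘ (a ∷_) ⟩ + merged)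
    ≡⟨ cong (λ z → ⟨ v ⋆ (a ∷ u) ∣ f ∘ (b ∷_) ⟩ + (⟨ (b ∷ v) ⋆ u ∣ f ∘ (a ∷_) ⟩ + z)) merged-comm ⟩
  ⟨ v ⋆ (a ∷ u) ∣ f ∘ (b ∷_) ⟩ + (⟨ (b ∷ v) ⋆ u ∣ f ∘ (a ∷_) ⟩ + ⟨ v ⋆ u ∣ f ∘ (b ⊕ a ∷_) ⟩)
    ≡⟨ ⋆-cons b v a u f ⟨
  ⟨ (b ∷ v) ⋆ (a ∷ u) ∣ f ⟩                          ∎
  where
  merged : ℚ
  merged = ⟨ u ⋆ v ∣ f ∘ (a ⊕ b ∷_) ⟩
  merged-comm : merged ≡ ⟨ v ⋆ u ∣ f ∘ (b ⊕ a ∷_) ⟩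
  merged-comm = trans (⋆-comm u v _) (⟨⟩-cong (stuffleW v u) (λ x → cong (λ c → f (suc c ∷ x)) (ℕP.+-comm a b)))

⋆-snoc-letter : ∀ v a b f → ⟨ (a ∷ []) ⋆ (v ∷ʳ b) ∣ f ⟩ ≡
  ⟨ [] ⋆ (v ∷ʳ b) ∣ f ∘ (_∷ʳ a) ⟩ + (⟨ (a ∷ []) ⋆ v ∣ f ∘ (_∷ʳ b) ⟩ + ⟨ [] ⋆ v ∣ f ∘ (_∷ʳ a ⊕ b) ⟩)
⋆-snoc-letter [] a b f = trans (⋆-cons a [] b [] f) (+-Props.x∙yz≈y∙xz ⟨ [] ⋆ (b ∷ []) ∣ f ∘ (a ∷_) ⟩ ⟨ (a ∷ []) ⋆ [] ∣ f ∘ (b ∷_) ⟩ ⟨ [] ⋆ [] ∣ f ∘ (a ⊕ b ∷_) ⟩)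
⋆-snoc-letter (b′ ∷ v) a b f = begin
  ⟨ (a ∷ []) ⋆ (b′ ∷ v ∷ʳ b) ∣ f ⟩
    ≡⟨ ⋆-cons a [] b′ (v ∷ʳ b) f ⟩
  P + (⟨ (a ∷ []) ⋆ (v ∷ʳ b) ∣ f ∘ (b′ ∷_) ⟩ + R)
    ≡⟨ cong (λ z → P + (z + R)) (⋆-snoc-letter v a b (f ∘ (b′ ∷_))) ⟩
  P + ((Q₁ + (Q₂ + Q₃)) + R)
    ≡⟨ rearrange P Q₁ Q₂ Q₃ R ⟩
  Q₁ + ((P + (Q₂ + R)) + Q₃)
    ≡⟨ cong (λ z → Q₁ + (z + Q₃)) (⋆-cons a [] b′ v (f ∘ (_∷ʳ b))) ⟨
  Q₁ + (⟨ (a ∷ []) ⋆ (b′ ∷ v) ∣ f ∘ (_∷ʳ b) ⟩ + Q₃) ∎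
  where
  P R Q₁ Q₂ Q₃ : ℚ
  P = ⟨ [] ⋆ (b′ ∷ (v ∷ʳ b)) ∣ f ∘ (a ∷_) ⟩
  R = ⟨ [] ⋆ (v ∷ʳ b) ∣ f ∘ (a ⊕ b′ ∷_) ⟩
  Q₁ = ⟨ [] ⋆ (v ∷ʳ b) ∣ f ∘ (b′ ∷_) ∘ (_∷ʳ a) ⟩
  Q₂ = ⟨ (a ∷ []) ⋆ v ∣ f ∘ (b′ ∷_) ∘ (_∷ʳ b) ⟩
  Q₃ = ⟨ [] ⋆ v ∣ f ∘ (b′ ∷_) ∘ (_∷ʳ a ⊕ b) ⟩
  rearrange : ∀ (p q₁ q₂ q₃ r : ℚ) → p + ((q₁ + (q₂ + q₃)) + r) ≡ q₁ + ((p + (q₂ + r)) + q₃)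
  rearrange = solve-∀ ℚ-ring

⋆-snoc : ∀ u v a b f → ⟨ (u ∷ʳ a) ⋆ (v ∷ʳ b) ∣ f ⟩ ≡
  ⟨ u ⋆ (v ∷ʳ b) ∣ f ∘ (_∷ʳ a) ⟩ + (⟨ (u ∷ʳ a) ⋆ v ∣ f ∘ (_∷ʳ b) ⟩ + ⟨ u ⋆ v ∣ f ∘ (_∷ʳ a ⊕ b) ⟩)
⋆-snoc [] v a b f = ⋆-snoc-letter v a b f
⋆-snoc (a′ ∷ u) [] a b f = begin
  ⟨ (a′ ∷ u ∷ʳ a) ⋆ (b ∷ []) ∣ f ⟩
    ≡⟨ ⋆-comm (a′ ∷ u ∷ʳ a) (b ∷ []) f ⟩
  ⟨ (b ∷ []) ⋆ (a′ ∷ u ∷ʳ a) ∣ f ⟩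
    ≡⟨ ⋆-snoc-letter (a′ ∷ u) b a f ⟩
  X + (⟨ (b ∷ []) ⋆ (a′ ∷ u) ∣ f ∘ (_∷ʳ a) ⟩ + ⟨ [] ⋆ (a′ ∷ u) ∣ f ∘ (_∷ʳ b ⊕ a) ⟩)
    ≡⟨ cong₂ (λ y z → X + (y + z)) (⋆-comm (b ∷ []) (a′ ∷ u) (f ∘ (_∷ʳ a)))
             (cong (λ c → ⟨ [] ⋆ (a′ ∷ u) ∣ f ∘ (_∷ʳ suc c) ⟩) (ℕP.+-comm b a)) ⟩
  X + (Y + Z)
    ≡⟨ +-Props.x∙yz≈y∙xz X Y Z ⟩
  Y + (X + Z) ∎
  where
  X Y Z : ℚ
  X = ⟨ [] ⋆ (a′ ∷ u ∷ʳ a) ∣ f ∘ (_∷ʳ b) ⟩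
  Y = ⟨ (a′ ∷ u) ⋆ (b ∷ []) ∣ f ∘ (_∷ʳ a) ⟩
  Z = ⟨ [] ⋆ (a′ ∷ u) ∣ f ∘ (_∷ʳ a ⊕ b) ⟩
⋆-snoc (a′ ∷ u) (b′ ∷ v) a b f = begin
  ⟨ (a′ ∷ u ∷ʳ a) ⋆ (b′ ∷ v ∷ʳ b) ∣ f ⟩
    ≡⟨ ⋆-cons a′ (u ∷ʳ a) b′ (v ∷ʳ b) f ⟩
  ⟨ (u ∷ʳ a) ⋆ (b′ ∷ v ∷ʳ b) ∣ f ∘ (a′ ∷_) ⟩ + (⟨ (a′ ∷ u ∷ʳ a) ⋆ (v ∷ʳ b) ∣ f ∘ (b′ ∷_) ⟩
    + ⟨ (u ∷ʳ a) ⋆ (v ∷ʳ b) ∣ f ∘ (a′ ⊕ b′ ∷_) ⟩)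
    ≡⟨ cong₂ _+_ (⋆-snoc u (b′ ∷ v) a b (f ∘ (a′ ∷_)))
         (cong₂ _+_ (⋆-snoc (a′ ∷ u) v a b (f ∘ (b′ ∷_))) (⋆-snoc u v a b (f ∘ (a′ ⊕ b′ ∷_)))) ⟩
  (x₁ + (x₂ + x₃)) + ((y₁ + (y₂ + y₃)) + (z₁ + (z₂ + z₃)))
    ≡⟨ transpose x₁ x₂ x₃ y₁ y₂ y₃ z₁ z₂ z₃ ⟩
  (x₁ + (y₁ + z₁)) + ((x₂ + (y₂ + z₂)) + (x₃ + (y₃ + z₃)))
    ≡⟨ cong₂ _+_ (⋆-cons a′ u b′ (v ∷ʳ b) (f ∘ (_∷ʳ a)))
         (cong₂ _+_ (⋆-cons a′ (u ∷ʳ a) b′ v (f ∘ (_∷ʳ b))) (⋆-cons a′ u b′ v (f ∘ (_∷ʳ a ⊕ b)))) ⟨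
  ⟨ (a′ ∷ u) ⋆ (b′ ∷ v ∷ʳ b) ∣ f ∘ (_∷ʳ a) ⟩ + (⟨ (a′ ∷ u ∷ʳ a) ⋆ (b′ ∷ v) ∣ f ∘ (_∷ʳ b) ⟩
    + ⟨ (a′ ∷ u) ⋆ (b′ ∷ v) ∣ f ∘ (_∷ʳ a ⊕ b) ⟩) ∎
  where
  -- x, y, z: the three terms of the recursion on first letters;
  -- indices 1, 2, 3: the three terms of the recursion on last letters.
  x₁ x₂ x₃ y₁ y₂ y₃ z₁ z₂ z₃ : ℚ
  x₁ = ⟨ u ⋆ (b′ ∷ v ∷ʳ b) ∣ f ∘ (a′ ∷_) ∘ (_∷ʳ a) ⟩
  x₂ = ⟨ (u ∷ʳ a) ⋆ (b′ ∷ v) ∣ f ∘ (a′ ∷_) ∘ (_∷ʳ b) ⟩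
  x₃ = ⟨ u ⋆ (b′ ∷ v) ∣ f ∘ (a′ ∷_) ∘ (_∷ʳ a ⊕ b) ⟩
  y₁ = ⟨ (a′ ∷ u) ⋆ (v ∷ʳ b) ∣ f ∘ (b′ ∷_) ∘ (_∷ʳ a) ⟩
  y₂ = ⟨ (a′ ∷ u ∷ʳ a) ⋆ v ∣ f ∘ (b′ ∷_) ∘ (_∷ʳ b) ⟩
  y₃ = ⟨ (a′ ∷ u) ⋆ v ∣ f ∘ (b′ ∷_) ∘ (_∷ʳ a ⊕ b) ⟩
  z₁ = ⟨ u ⋆ (v ∷ʳ b) ∣ f ∘ (a′ ⊕ b′ ∷_) ∘ (_∷ʳ a) ⟩
  z₂ = ⟨ (u ∷ʳ a) ⋆ v ∣ f ∘ (a′ ⊕ b′ ∷_) ∘ (_∷ʳ b) ⟩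
  z₃ = ⟨ u ⋆ v ∣ f ∘ (a′ ⊕ b′ ∷_) ∘ (_∷ʳ a ⊕ b) ⟩
  transpose : ∀ (x₁ x₂ x₃ y₁ y₂ y₃ z₁ z₂ z₃ : ℚ) →
    (x₁ + (x₂ + x₃)) + ((y₁ + (y₂ + y₃)) + (z₁ + (z₂ + z₃))) ≡
    (x₁ + (y₁ + z₁)) + ((x₂ + (y₂ + z₂)) + (x₃ + (y₃ + z₃)))
  transpose = solve-∀ ℚ-ring

-- Reversal is an anti-automorphism of the stuffle: the left recursion for
-- u, v is the reverse of the right recursion for reverse u, reverse v.
⋆-reverse : ∀ u v f → ⟨ u ⋆ v ∣ f ∘ reverse ⟩ ≡ ⟨ reverse u ⋆ reverse v ∣ f ⟩
⋆-reverse [] v f = trans (⋆-nilˡ v (f ∘ reverse)) (sym (⋆-nilˡ (reverse v) f))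
⋆-reverse (a ∷ u) [] f = trans (⋆-nilʳ (a ∷ u) (f ∘ reverse)) (sym (⋆-nilʳ (reverse (a ∷ u)) f))
⋆-reverse (a ∷ u) (b ∷ v) f = begin
  ⟨ (a ∷ u) ⋆ (b ∷ v) ∣ f ∘ reverse ⟩
    ≡⟨ ⋆-cons a u b v (f ∘ reverse) ⟩
  ⟨ u ⋆ (b ∷ v) ∣ f ∘ reverse ∘ (a ∷_) ⟩ + (⟨ (a ∷ u) ⋆ v ∣ f ∘ reverse ∘ (b ∷_) ⟩
    + ⟨ u ⋆ v ∣ f ∘ reverse ∘ (a ⊕ b ∷_) ⟩)
    ≡⟨ cong₂ _+_ (lastLetter a u (b ∷ v) f (⋆-reverse u (b ∷ v) (f ∘ (_∷ʳ a))))
         (cong₂ _+_ (lastLetter b (a ∷ u) v f (⋆-reverse (a ∷ u) v (f ∘ (_∷ʳ b))))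
                    (lastLetter (a ⊕ b) u v f (⋆-reverse u v (f ∘ (_∷ʳ a ⊕ b))))) ⟩
  ⟨ reverse u ⋆ reverse (b ∷ v) ∣ f ∘ (_∷ʳ a) ⟩ + (⟨ reverse (a ∷ u) ⋆ reverse v ∣ f ∘ (_∷ʳ b) ⟩
    + ⟨ reverse u ⋆ reverse v ∣ f ∘ (_∷ʳ a ⊕ b) ⟩)
    ≡⟨ cong₂ (λ x y → ⟨ reverse u ⋆ x ∣ f ∘ (_∷ʳ a) ⟩ + (⟨ y ⋆ reverse v ∣ f ∘ (_∷ʳ b) ⟩ + ⟨ reverse u ⋆ reverse v ∣ f ∘ (_∷ʳ a ⊕ b) ⟩))
         (unfold-reverse b v) (unfold-reverse a u) ⟩
  ⟨ reverse u ⋆ (reverse v ∷ʳ b) ∣ f ∘ (_∷ʳ a) ⟩ + (⟨ (reverse u ∷ʳ a) ⋆ reverse v ∣ f ∘ (_∷ʳ b) ⟩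
    + ⟨ reverse u ⋆ reverse v ∣ f ∘ (_∷ʳ a ⊕ b) ⟩)
    ≡⟨ ⋆-snoc (reverse u) (reverse v) a b f ⟨
  ⟨ (reverse u ∷ʳ a) ⋆ (reverse v ∷ʳ b) ∣ f ⟩
    ≡⟨ cong₂ (λ x y → ⟨ x ⋆ y ∣ f ⟩) (unfold-reverse a u) (unfold-reverse b v) ⟨
  ⟨ reverse (a ∷ u) ⋆ reverse (b ∷ v) ∣ f ⟩ ∎
  where
  lastLetter : ∀ c x y g → ⟨ x ⋆ y ∣ g ∘ (_∷ʳ c) ∘ reverse ⟩ ≡ ⟨ reverse x ⋆ reverse y ∣ g ∘ (_∷ʳ c) ⟩ →
    ⟨ x ⋆ y ∣ g ∘ reverse ∘ (c ∷_) ⟩ ≡ ⟨ reverse x ⋆ reverse y ∣ g ∘ (_∷ʳ c) ⟩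
  lastLetter c x y g = trans (⟨⟩-cong (stuffleW x y) (λ z → cong g (unfold-reverse c z)))

weight : Word → ℕ
weight = foldr (λ k acc → index k ℕ.+ acc) 0

⋆-homogeneous : ∀ u v (F : ℕ → Word → ℚ) →
  ⟨ u ⋆ v ∣ (λ x → F (weight x) x) ⟩ ≡ ⟨ u ⋆ v ∣ F (weight u ℕ.+ weight v) ⟩
⋆-homogeneous [] v F = trans (⋆-nilˡ v (λ x → F (weight x) x)) (sym (⋆-nilˡ v (F (weight v))))
⋆-homogeneous (a ∷ u) [] F =
  trans (⋆-nilʳ (a ∷ u) (λ x → F (weight x) x))
  (sym (trans (⋆-nilʳ (a ∷ u) (F (weight (a ∷ u) ℕ.+ 0))) (cong (λ n → F n (a ∷ u)) (ℕP.+-identityʳ (weight (a ∷ u))))))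
⋆-homogeneous (a ∷ u) (b ∷ v) F = begin
  ⟨ (a ∷ u) ⋆ (b ∷ v) ∣ (λ x → F (weight x) x) ⟩
    ≡⟨ ⋆-cons a u b v (λ x → F (weight x) x) ⟩
  ⟨ u ⋆ (b ∷ v) ∣ (λ x → F (suc a ℕ.+ weight x) (a ∷ x)) ⟩
    + (⟨ (a ∷ u) ⋆ v ∣ (λ x → F (suc b ℕ.+ weight x) (b ∷ x)) ⟩
    + ⟨ u ⋆ v ∣ (λ x → F (suc (a ⊕ b) ℕ.+ weight x) (a ⊕ b ∷ x)) ⟩)
    ≡⟨ cong₂ _+_ (⋆-homogeneous u (b ∷ v) (λ n → F (suc a ℕ.+ n) ∘ (a ∷_)))
         (cong₂ _+_ (⋆-homogeneous (a ∷ u) v (λ n → F (suc b ℕ.+ n) ∘ (b ∷_)))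
                    (⋆-homogeneous u v (λ n → F (suc (a ⊕ b) ℕ.+ n) ∘ (a ⊕ b ∷_)))) ⟩
  ⟨ u ⋆ (b ∷ v) ∣ F (suc a ℕ.+ (U ℕ.+ (suc b ℕ.+ V))) ∘ (a ∷_) ⟩
    + (⟨ (a ∷ u) ⋆ v ∣ F (suc b ℕ.+ ((suc a ℕ.+ U) ℕ.+ V)) ∘ (b ∷_) ⟩
    + ⟨ u ⋆ v ∣ F (suc (a ⊕ b) ℕ.+ (U ℕ.+ V)) ∘ (a ⊕ b ∷_) ⟩)
    ≡⟨ cong₂ _+_ (reweigh u (b ∷ v) a (first a b U V))
         (cong₂ _+_ (reweigh (a ∷ u) v b (second a b U V)) (reweigh u v (a ⊕ b) (merged a b U V))) ⟩
  ⟨ u ⋆ (b ∷ v) ∣ F W ∘ (a ∷_) ⟩ + (⟨ (a ∷ u) ⋆ v ∣ F W ∘ (b ∷_) ⟩ + ⟨ u ⋆ v ∣ F W ∘ (a ⊕ b ∷_) ⟩)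
    ≡⟨ ⋆-cons a u b v (F W) ⟨
  ⟨ (a ∷ u) ⋆ (b ∷ v) ∣ F W ⟩ ∎
  where
  U V W : ℕ
  U = weight u
  V = weight v
  W = (suc a ℕ.+ U) ℕ.+ (suc b ℕ.+ V)
  reweigh : ∀ x y c {m n} → m ≡ n → ⟨ x ⋆ y ∣ F m ∘ (c ∷_) ⟩ ≡ ⟨ x ⋆ y ∣ F n ∘ (c ∷_) ⟩
  reweigh x y c eq = cong (λ n → ⟨ x ⋆ y ∣ F n ∘ (c ∷_) ⟩) eq
  first : ∀ a b U V → suc a ℕ.+ (U ℕ.+ (suc b ℕ.+ V)) ≡ (suc a ℕ.+ U) ℕ.+ (suc b ℕ.+ V)
  first = solve-∀-ℕ
  second : ∀ a b U V → suc b ℕ.+ ((suc a ℕ.+ U) ℕ.+ V) ≡ (suc a ℕ.+ U) ℕ.+ (suc b ℕ.+ V)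
  second = solve-∀-ℕ
  merged : ∀ a b U V → suc (suc (a ℕ.+ b)) ℕ.+ (U ℕ.+ V) ≡ (suc a ℕ.+ U) ℕ.+ (suc b ℕ.+ V)
  merged = solve-∀-ℕ

sgn-+ : ∀ m n → sgn (m ℕ.+ n) ≡ sgn m * sgn n
sgn-+ zero n = sym (ℚP.*-identityˡ (sgn n))
sgn-+ (suc m) n = trans (cong -_ (sgn-+ m n)) (ℚP.neg-distribˡ-* (sgn m) (sgn n))

⋆-sign : ∀ u v g →
  ⟨ u ⋆ v ∣ (λ x → sgn (weight x) * g x) ⟩ ≡ sgn (weight u) * (sgn (weight v) * ⟨ u ⋆ v ∣ g ⟩)
⋆-sign u v g = begin
  ⟨ u ⋆ v ∣ (λ x → sgn (weight x) * g x) ⟩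
    ≡⟨ ⋆-homogeneous u v (λ n x → sgn n * g x) ⟩
  ⟨ u ⋆ v ∣ (λ x → sgn (weight u ℕ.+ weight v) * g x) ⟩
    ≡⟨ ⟨⟩-* (stuffleW u v) (sgn (weight u ℕ.+ weight v)) g ⟩
  sgn (weight u ℕ.+ weight v) * ⟨ u ⋆ v ∣ g ⟩
    ≡⟨ cong (_* ⟨ u ⋆ v ∣ g ⟩) (sgn-+ (weight u) (weight v)) ⟩
  sgn (weight u) * sgn (weight v) * ⟨ u ⋆ v ∣ g ⟩
    ≡⟨ ℚP.*-assoc (sgn (weight u)) (sgn (weight v)) _ ⟩
  sgn (weight u) * (sgn (weight v) * ⟨ u ⋆ v ∣ g ⟩) ∎

⟨⟩-∗ : ∀ p q f → ⟨ p ∗ q ∣ f ⟩ ≡ ⟨ p ∣ (λ u → ⟨ q ∣ (λ v → ⟨ u ⋆ v ∣ f ⟩) ⟩) ⟩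
⟨⟩-∗ p q f = ⟨⟩-linearExtension _ _ p f (λ c u → inner c u _ (λ d v → refl))
  where
  inner : ∀ c u (G : ℚ × Word → H) → (∀ d v → G (d , v) ≡ scale (c * d) (stuffleW u v)) →
    ⟨ concatMap G q ∣ f ⟩ ≡ c * ⟨ q ∣ (λ v → ⟨ u ⋆ v ∣ f ⟩) ⟩
  inner c u G G≡ =
    trans (⟨⟩-linearExtension G (λ v → c * ⟨ u ⋆ v ∣ f ⟩) q f
             (λ d v → trans (cong ⟨_∣ f ⟩ (G≡ d v))
                      (trans (⟨⟩-scale (c * d) (stuffleW u v) f) (*-Props.xy∙z≈y∙xz c d ⟨ u ⋆ v ∣ f ⟩))))
          (⟨⟩-* q c (λ v → ⟨ u ⋆ v ∣ f ⟩))

⟨⟩-inv : ∀ p f → ⟨ inv p ∣ f ⟩ ≡ ⟨ p ∣ (λ x → sgn (weight x) * f (reverse x)) ⟩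
⟨⟩-inv [] f = refl
⟨⟩-inv ((c , w) ∷ p) f = cong₂ _+_ (ℚP.*-assoc c (sgn (weight w)) (f (reverse w))) (⟨⟩-inv p f)

-- Statement (i) on words: inv(u ⋆ v) = inv v ⋆ inv u.
⋆-inv : ∀ u v f → ⟨ u ⋆ v ∣ (λ x → sgn (weight x) * f (reverse x)) ⟩
                  ≡ sgn (weight v) * (sgn (weight u) * ⟨ reverse v ⋆ reverse u ∣ f ⟩)
⋆-inv u v f = begin
  ⟨ u ⋆ v ∣ (λ x → sgn (weight x) * f (reverse x)) ⟩
    ≡⟨ ⋆-sign u v (f ∘ reverse) ⟩
  su * (sv * ⟨ u ⋆ v ∣ f ∘ reverse ⟩)
    ≡⟨ cong (λ z → su * (sv * z)) (trans (⋆-reverse u v f) (⋆-comm (reverse u) (reverse v) f)) ⟩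
  su * (sv * ⟨ reverse v ⋆ reverse u ∣ f ⟩)
    ≡⟨ *-Props.x∙yz≈y∙xz su sv ⟨ reverse v ⋆ reverse u ∣ f ⟩ ⟩
  sv * (su * ⟨ reverse v ⋆ reverse u ∣ f ⟩) ∎
  where
  su sv : ℚ
  su = sgn (weight u)
  sv = sgn (weight v)

inv-antimorphism : (u v : H) → inv (u ∗ v) ≈ᴴ inv v ∗ inv u
inv-antimorphism p q = ≈ᴴ-byPairing (inv (p ∗ q)) (inv q ∗ inv p) λ f → begin
  ⟨ inv (p ∗ q) ∣ f ⟩
    ≡⟨ trans (⟨⟩-inv (p ∗ q) f) (⟨⟩-∗ p q _) ⟩
  ⟨ p ∣ (λ u → ⟨ q ∣ (λ v → ⟨ u ⋆ v ∣ (λ x → sgn (weight x) * f (reverse x)) ⟩) ⟩) ⟩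
    ≡⟨ ⟨⟩-cong p (λ u → ⟨⟩-cong q (λ v → ⋆-inv u v f)) ⟩
  ⟨ p ∣ (λ u → ⟨ q ∣ (λ v → sgn (weight v) * (sgn (weight u) * ⟨ reverse v ⋆ reverse u ∣ f ⟩)) ⟩) ⟩
    ≡⟨ ⟨⟩-swap p q _ ⟩
  ⟨ q ∣ (λ v → ⟨ p ∣ (λ u → sgn (weight v) * (sgn (weight u) * ⟨ reverse v ⋆ reverse u ∣ f ⟩)) ⟩) ⟩
    ≡⟨ ⟨⟩-cong q (λ v → trans (⟨⟩-* p (sgn (weight v)) _) (cong (sgn (weight v) *_) (sym (⟨⟩-inv p _)))) ⟩
  ⟨ q ∣ (λ v → sgn (weight v) * ⟨ inv p ∣ (λ u′ → ⟨ reverse v ⋆ u′ ∣ f ⟩) ⟩) ⟩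
    ≡⟨ trans (⟨⟩-∗ (inv q) (inv p) f) (⟨⟩-inv q _) ⟨
  ⟨ inv q ∗ inv p ∣ f ⟩ ∎

ℕtoℚ-+ : ∀ m n → ℕtoℚ (m ℕ.+ n) ≡ ℕtoℚ m + ℕtoℚ n
ℕtoℚ-+ m n = sym (begin
  ℕtoℚ m + ℕtoℚ n
    ≡⟨ cong₂ _+_ (asFraction m) (asFraction n) ⟩
  mkℚ (ℤ.+ m) 0 (coprime-1 m) + mkℚ (ℤ.+ n) 0 (coprime-1 n)
    ≡⟨ cong (ℚ._/ 1) (trans (cong₂ ℤ._+_ (ℤP.*-identityʳ (ℤ.+ m)) (ℤP.*-identityʳ (ℤ.+ n))) (sym (ℤP.pos-+ m n))) ⟩
  ℕtoℚ (m ℕ.+ n) ∎)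
  where
  coprime-1 : ∀ n → Coprime n 1
  coprime-1 n = Coprimality.sym (1-coprimeTo n)
  asFraction : ∀ n → ℕtoℚ n ≡ mkℚ (ℤ.+ n) 0 (coprime-1 n)
  asFraction n = ℚP.normalize-coprime (coprime-1 n)

-- multichoose c m = binom(m+c, m): the coefficient of T^m in (1-T)^-(c+1).
multichoose : ℕ → ℕ → ℚ
multichoose c m = ℕtoℚ ((m ℕ.+ c) C m)

multichoose-zero : ∀ m → multichoose 0 m ≡ 1ℚ
multichoose-zero m = cong ℕtoℚ (trans (cong (_C m) (ℕP.+-identityʳ m)) (nCn≡1 m))

multichoose-pascal : ∀ c m → multichoose (suc c) (suc m) ≡ multichoose (suc c) m + multichoose c (suc m)
multichoose-pascal c m = trans (cong ℕtoℚ pascal) (ℕtoℚ-+ ((m ℕ.+ suc c) C m) ((suc m ℕ.+ c) C suc m))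
  where
  pascal : (suc m ℕ.+ suc c) C suc m ≡ (m ℕ.+ suc c) C m ℕ.+ (suc m ℕ.+ c) C suc m
  pascal = begin
    suc (m ℕ.+ suc c) C suc m                            ≡⟨ cong (λ z → suc z C suc m) (ℕP.+-suc m c) ⟩
    suc (suc (m ℕ.+ c)) C suc m                          ≡⟨ nCk+nC[k+1]≡[n+1]C[k+1] (suc (m ℕ.+ c)) m ⟨
    suc (m ℕ.+ c) C m ℕ.+ suc (m ℕ.+ c) C suc m          ≡⟨ cong (λ z → z C m ℕ.+ suc (m ℕ.+ c) C suc m) (ℕP.+-suc m c) ⟨
    (m ℕ.+ suc c) C m ℕ.+ (suc m ℕ.+ c) C suc m          ∎

-- Vandermonde's identity  (1-T)^-(a+1) · (1-T)^-(b+1) = (1-T)^-(a+b+2).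
vandermonde : ∀ a b k → Σ₂ k (λ l m → multichoose a l * multichoose b m) ≡ multichoose (a ⊕ b) k
vandermonde a b zero = refl
vandermonde a zero (suc k) = begin
  Σ₂ (suc k) (λ l m → M a l * M 0 m)
    ≡⟨ Σ₂-last k (λ l m → M a l * M 0 m) ⟩
  Σ₂ k (λ l m → M a l * M 0 (suc m)) + M a (suc k) * 1ℚ
    ≡⟨ cong₂ _+_ (Σ₂-cong k (λ l m → cong (M a l *_) (trans (multichoose-zero (suc m)) (sym (multichoose-zero m)))))
                 (ℚP.*-identityʳ (M a (suc k))) ⟩
  Σ₂ k (λ l m → M a l * M 0 m) + M a (suc k)
    ≡⟨ cong (_+ M a (suc k)) (vandermonde a zero k) ⟩
  M (a ⊕ 0) k + M a (suc k)
    ≡⟨ cong (λ c → M (suc c) k + M a (suc k)) (ℕP.+-identityʳ a) ⟩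
  M (suc a) k + M a (suc k)
    ≡⟨ multichoose-pascal a k ⟨
  M (suc a) (suc k)
    ≡⟨ cong (λ c → M (suc c) (suc k)) (ℕP.+-identityʳ a) ⟨
  M (a ⊕ 0) (suc k) ∎
  where
  M : ℕ → ℕ → ℚ
  M = multichoose
vandermonde a (suc b) (suc k) = begin
  Σ₂ (suc k) (λ l m → M a l * M (suc b) m)
    ≡⟨ Σ₂-last k (λ l m → M a l * M (suc b) m) ⟩
  Σ₂ k (λ l m → M a l * M (suc b) (suc m)) + M a (suc k) * 1ℚ
    ≡⟨ cong (_+ M a (suc k) * 1ℚ) (trans (Σ₂-cong k (λ l m → trans (cong (M a l *_) (multichoose-pascal b m))
                                                                    (ℚP.*-distribˡ-+ (M a l) (M (suc b) m) (M b (suc m)))))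
                                         (Σ₂-+ k (λ l m → M a l * M (suc b) m) (λ l m → M a l * M b (suc m)))) ⟩
  (Σ₂ k (λ l m → M a l * M (suc b) m) + Σ₂ k (λ l m → M a l * M b (suc m))) + M a (suc k) * 1ℚ
    ≡⟨ ℚP.+-assoc (Σ₂ k (λ l m → M a l * M (suc b) m)) (Σ₂ k (λ l m → M a l * M b (suc m))) (M a (suc k) * 1ℚ) ⟩
  Σ₂ k (λ l m → M a l * M (suc b) m) + (Σ₂ k (λ l m → M a l * M b (suc m)) + M a (suc k) * 1ℚ)
    ≡⟨ cong₂ _+_ (vandermonde a (suc b) k)
                 (trans (sym (Σ₂-last k (λ l m → M a l * M b m))) (vandermonde a b (suc k))) ⟩
  M (a ⊕ suc b) k + M (a ⊕ b) (suc k)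
    ≡⟨ cong (M (a ⊕ suc b) k +_) (cong (λ c → M c (suc k)) (ℕP.+-suc a b)) ⟨
  M (suc (a ℕ.+ suc b)) k + M (a ℕ.+ suc b) (suc k)
    ≡⟨ multichoose-pascal (a ℕ.+ suc b) k ⟨
  M (a ⊕ suc b) (suc k) ∎
  where
  M : ℕ → ℕ → ℚ
  M = multichoose

-- The coefficient of (-T)^l y_(s+l) in ι(y_s), for the letter a coding y_s.
coefficient : Letter → ℕ → ℚ
coefficient a l = sgn l * multichoose a l

-- The letter substitution y_s ↦ Σ_l coefficient · T^l y_(s+l) is compatible with
-- merging letters: this is where Vandermonde's identity enters.
coefficient-merge : ∀ a b k → Σ₂ k (λ l m → coefficient a l * coefficient b m) ≡ coefficient (a ⊕ b) k
coefficient-merge a b k = begin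
  Σ₂ k (λ l m → coefficient a l * coefficient b m)
    ≡⟨ Σ₂-cong-diag k (λ l m l+m≡k → trans (interchange (sgn l) (multichoose a l) (sgn m) (multichoose b m))
                         (cong (_* (multichoose a l * multichoose b m)) (trans (sym (sgn-+ l m)) (cong sgn l+m≡k)))) ⟩
  Σ₂ k (λ l m → sgn k * (multichoose a l * multichoose b m))
    ≡⟨ Σ₂-* k (sgn k) (λ l m → multichoose a l * multichoose b m) ⟩
  sgn k * Σ₂ k (λ l m → multichoose a l * multichoose b m)
    ≡⟨ cong (sgn k *_) (vandermonde a b k) ⟩
  coefficient (a ⊕ b) k ∎
  where
  interchange : ∀ (p x q y : ℚ) → (p * x) * (q * y) ≡ (p * q) * (x * y)
  interchange = solve-∀ ℚ-ring

ι-cons : ∀ a x n f → ⟨ ιW (a ∷ x) n ∣ f ⟩ ≡ Σ₂ n (λ l j → coefficient a l * ⟨ ιW x j ∣ f ∘ (a ℕ.+ l ∷_) ⟩)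
ι-cons a x n f =
  trans (⟨⟩-concatMap-upTo (λ l → scale (coefficient a l) (prepend (a ℕ.+ l) (ιW x (n ℕ.∸ l)))) (suc n) f)
        (Σ<-cong (suc n) (λ l → trans (⟨⟩-scale (coefficient a l) (prepend (a ℕ.+ l) (ιW x (n ℕ.∸ l))) f)
                                      (cong (coefficient a l *_) (⟨⟩-prepend (a ℕ.+ l) (ιW x (n ℕ.∸ l)) f))))

-- The coefficient of T^n in ι u ∗ₜ ι v, paired with the bilinear kernel K.
ι⊗ι : Word → Word → ℕ → (Word → Word → ℚ) → ℚ
ι⊗ι u v n K = Σ₂ n (λ i j → ⟨ ιW u i ∣ (λ x → ⟨ ιW v j ∣ K x ⟩) ⟩)

ι⊗ι-cong : ∀ u v n {K L : Word → Word → ℚ} → (∀ x y → K x y ≡ L x y) → ι⊗ι u v n K ≡ ι⊗ι u v n L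
ι⊗ι-cong u v n e = Σ₂-cong n (λ i j → ⟨⟩-cong (ιW u i) (λ x → ⟨⟩-cong (ιW v j) (e x)))

ι⊗ι-+ : ∀ u v n (K L : Word → Word → ℚ) → ι⊗ι u v n (λ x y → K x y + L x y) ≡ ι⊗ι u v n K + ι⊗ι u v n L
ι⊗ι-+ u v n K L = trans (Σ₂-cong n split) (Σ₂-+ n (pairing K) (pairing L))
  where
  split : ∀ i j → ⟨ ιW u i ∣ (λ x → ⟨ ιW v j ∣ (λ y → K x y + L x y) ⟩) ⟩
                ≡ ⟨ ιW u i ∣ (λ x → ⟨ ιW v j ∣ K x ⟩) ⟩ + ⟨ ιW u i ∣ (λ x → ⟨ ιW v j ∣ L x ⟩) ⟩
  split i j = trans (⟨⟩-cong (ιW u i) (λ x → ⟨⟩-+ (ιW v j) (K x) (L x)))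
                    (⟨⟩-+ (ιW u i) (λ x → ⟨ ιW v j ∣ K x ⟩) (λ x → ⟨ ιW v j ∣ L x ⟩))
  pairing : (Word → Word → ℚ) → ℕ → ℕ → ℚ
  pairing M i j = ⟨ ιW u i ∣ (λ x → ⟨ ιW v j ∣ M x ⟩) ⟩

ι⊗ι-flip : ∀ u v n K → ι⊗ι u v n K ≡ ι⊗ι v u n (λ y x → K x y)
ι⊗ι-flip u v n K = trans (Σ₂-comm n (λ i j → ⟨ ιW u i ∣ (λ x → ⟨ ιW v j ∣ K x ⟩) ⟩)) (Σ₂-cong n (λ i j → ⟨⟩-swap (ιW u j) (ιW v i) K))

ι⊗ι-nilˡ : ∀ v n K → ι⊗ι [] v n K ≡ ⟨ ιW v n ∣ K [] ⟩
ι⊗ι-nilˡ v n K = trans (Σ₂-first n (λ i j → ⟨ ιW [] i ∣ (λ x → ⟨ ιW v j ∣ K x ⟩) ⟩) (λ i j → refl)) (⋆-nilˡ [] (λ x → ⟨ ιW v n ∣ K x ⟩))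

ι⊗ι-nilʳ : ∀ u n K → ι⊗ι u [] n K ≡ ⟨ ιW u n ∣ (λ x → K x []) ⟩
ι⊗ι-nilʳ u n K = trans (ι⊗ι-flip u [] n K) (ι⊗ι-nilˡ u n (λ y x → K x y))

ι⊗ι-consˡ : ∀ a u w n K →
  ι⊗ι (a ∷ u) w n K ≡ Σ₂ n (λ l s → coefficient a l * ι⊗ι u w s (λ x y → K (a ℕ.+ l ∷ x) y))
ι⊗ι-consˡ a u w n K = begin
  ι⊗ι (a ∷ u) w n K
    ≡⟨ Σ₂-cong n (λ i r → ι-cons a u i (λ x → ⟨ ιW w r ∣ K x ⟩)) ⟩
  Σ₂ n (λ i r → Σ₂ i (λ l j → c l * ⟨ ιW u j ∣ (λ x → ⟨ ιW w r ∣ K (a ℕ.+ l ∷ x) ⟩) ⟩))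
    ≡⟨ Σ₂-assoc n (λ l j r → c l * ⟨ ιW u j ∣ (λ x → ⟨ ιW w r ∣ K (a ℕ.+ l ∷ x) ⟩) ⟩) ⟩
  Σ₂ n (λ l s → Σ₂ s (λ j r → c l * ⟨ ιW u j ∣ (λ x → ⟨ ιW w r ∣ K (a ℕ.+ l ∷ x) ⟩) ⟩))
    ≡⟨ Σ₂-cong n (λ l s → Σ₂-* s (c l) (λ j r → ⟨ ιW u j ∣ (λ x → ⟨ ιW w r ∣ K (a ℕ.+ l ∷ x) ⟩) ⟩)) ⟩
  Σ₂ n (λ l s → c l * ι⊗ι u w s (λ x y → K (a ℕ.+ l ∷ x) y)) ∎
  where
  c : ℕ → ℚ
  c = coefficient a

ι⊗ι-consʳ : ∀ b u v n K →
  ι⊗ι u (b ∷ v) n K ≡ Σ₂ n (λ m s → coefficient b m * ι⊗ι u v s (λ x y → K x (b ℕ.+ m ∷ y)))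
ι⊗ι-consʳ b u v n K =
  trans (ι⊗ι-flip u (b ∷ v) n K)
  (trans (ι⊗ι-consˡ b v u n (λ y x → K x y))
         (Σ₂-cong n (λ m s → cong (coefficient b m *_) (sym (ι⊗ι-flip u v s (λ x y → K x (b ℕ.+ m ∷ y)))))))

leadingLetters : Letter → Letter → ℕ → (ℕ → ℕ → ℕ → ℚ) → ℚ
leadingLetters a b n X = Σ₂ n (λ l r → coefficient a l * Σ₂ r (λ m s → coefficient b m * X l m s))

ι⊗ι-cons : ∀ a u b v n K → ι⊗ι (a ∷ u) (b ∷ v) n K
  ≡ leadingLetters a b n (λ l m s → ι⊗ι u v s (λ x y → K (a ℕ.+ l ∷ x) (b ℕ.+ m ∷ y)))
ι⊗ι-cons a u b v n K =
  trans (ι⊗ι-consˡ a u (b ∷ v) n K)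
        (Σ₂-cong n (λ l r → cong (coefficient a l *_) (ι⊗ι-consʳ b u v r (λ x → K (a ℕ.+ l ∷ x)))))

leadingLetters-cong : ∀ a b n {X Y : ℕ → ℕ → ℕ → ℚ} → (∀ l m s → X l m s ≡ Y l m s) →
  leadingLetters a b n X ≡ leadingLetters a b n Y
leadingLetters-cong a b n e =
  Σ₂-cong n (λ l r → cong (coefficient a l *_) (Σ₂-cong r (λ m s → cong (coefficient b m *_) (e l m s))))

leadingLetters-+ : ∀ a b n (X Y : ℕ → ℕ → ℕ → ℚ) →
  leadingLetters a b n (λ l m s → X l m s + Y l m s) ≡ leadingLetters a b n X + leadingLetters a b n Y
leadingLetters-+ a b n X Y =
  trans (Σ₂-cong n (λ l r → trans (cong (ca l *_) (trans (Σ₂-cong r (λ m s → ℚP.*-distribˡ-+ (cb m) (X l m s) (Y l m s)))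
                                                         (Σ₂-+ r (inner X l) (inner Y l))))
                                  (ℚP.*-distribˡ-+ (ca l) (Σ₂ r (inner X l)) (Σ₂ r (inner Y l)))))
        (Σ₂-+ n (λ l r → ca l * Σ₂ r (inner X l)) (λ l r → ca l * Σ₂ r (inner Y l)))
  where
  ca cb : ℕ → ℚ
  ca = coefficient a
  cb = coefficient b
  inner : (ℕ → ℕ → ℕ → ℚ) → ℕ → ℕ → ℕ → ℚ
  inner Z l m s = cb m * Z l m s

leadingLetters-expand : ∀ a b n X → leadingLetters a b n X
  ≡ Σ₂ n (λ l r → Σ₂ r (λ m s → coefficient a l * (coefficient b m * X l m s)))
leadingLetters-expand a b n X =
  Σ₂-cong n (λ l r → sym (Σ₂-* r (coefficient a l) (λ m s → coefficient b m * X l m s)))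

leadingLetters-exchange : ∀ a b n X → leadingLetters a b n X ≡ leadingLetters b a n (λ m l s → X l m s)
leadingLetters-exchange a b n X = begin
  leadingLetters a b n X
    ≡⟨ leadingLetters-expand a b n X ⟩
  Σ₂ n (λ l r → Σ₂ r (λ m s → ca l * (cb m * X l m s)))
    ≡⟨ Σ₂-cong n (λ l r → Σ₂-cong r (λ m s → *-Props.x∙yz≈y∙xz (ca l) (cb m) (X l m s))) ⟩
  Σ₂ n (λ l r → Σ₂ r (λ m s → cb m * (ca l * X l m s)))
    ≡⟨ Σ₂-exchange n (λ l m s → cb m * (ca l * X l m s)) ⟩
  Σ₂ n (λ m r → Σ₂ r (λ l s → cb m * (ca l * X l m s)))
    ≡⟨ leadingLetters-expand b a n (λ m l s → X l m s) ⟨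
  leadingLetters b a n (λ m l s → X l m s) ∎
  where
  ca cb : ℕ → ℚ
  ca = coefficient a
  cb = coefficient b

leadingLetters-merge : ∀ a b n (Y : ℕ → ℕ → ℚ) →
  leadingLetters a b n (λ l m s → Y (l ℕ.+ m) s) ≡ Σ₂ n (λ q s → coefficient (a ⊕ b) q * Y q s)
leadingLetters-merge a b n Y = begin
  leadingLetters a b n (λ l m s → Y (l ℕ.+ m) s)
    ≡⟨ leadingLetters-expand a b n (λ l m s → Y (l ℕ.+ m) s) ⟩
  Σ₂ n (λ l r → Σ₂ r (λ m s → ca l * (cb m * Y (l ℕ.+ m) s)))
    ≡⟨ Σ₂-assoc n (λ l m s → ca l * (cb m * Y (l ℕ.+ m) s)) ⟨
  Σ₂ n (λ q s → Σ₂ q (λ l m → ca l * (cb m * Y (l ℕ.+ m) s)))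
    ≡⟨ Σ₂-cong n merge ⟩
  Σ₂ n (λ q s → coefficient (a ⊕ b) q * Y q s) ∎
  where
  ca cb : ℕ → ℚ
  ca = coefficient a
  cb = coefficient b
  regroup : ∀ (c d y : ℚ) → c * (d * y) ≡ y * (c * d)
  regroup = solve-∀ ℚ-ring
  merge : ∀ q s → Σ₂ q (λ l m → ca l * (cb m * Y (l ℕ.+ m) s)) ≡ coefficient (a ⊕ b) q * Y q s
  merge q s = begin
    Σ₂ q (λ l m → ca l * (cb m * Y (l ℕ.+ m) s))
      ≡⟨ Σ₂-cong-diag q (λ l m l+m≡q → trans (regroup (ca l) (cb m) (Y (l ℕ.+ m) s)) (cong (λ k → Y k s * (ca l * cb m)) l+m≡q)) ⟩
    Σ₂ q (λ l m → Y q s * (ca l * cb m))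
      ≡⟨ Σ₂-* q (Y q s) (λ l m → ca l * cb m) ⟩
    Y q s * Σ₂ q (λ l m → ca l * cb m)
      ≡⟨ cong (Y q s *_) (coefficient-merge a b q) ⟩
    Y q s * coefficient (a ⊕ b) q
      ≡⟨ ℚP.*-comm (Y q s) (coefficient (a ⊕ b) q) ⟩
    coefficient (a ⊕ b) q * Y q s ∎

⋆-kernel : (Word → ℚ) → Word → Word → ℚ
⋆-kernel f x y = ⟨ x ⋆ y ∣ f ⟩

ι-⋆-letter : ∀ c u v n f →
  (∀ s g → ⟨ u ⋆ v ∣ (λ x → ⟨ ιW x s ∣ g ⟩) ⟩ ≡ ι⊗ι u v s (⋆-kernel g)) →
  ⟨ u ⋆ v ∣ (λ x → ⟨ ιW (c ∷ x) n ∣ f ⟩) ⟩ ≡ Σ₂ n (λ l s → coefficient c l * ι⊗ι u v s (⋆-kernel (f ∘ (c ℕ.+ l ∷_))))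
ι-⋆-letter c u v n f known = begin
  ⟨ u ⋆ v ∣ (λ x → ⟨ ιW (c ∷ x) n ∣ f ⟩) ⟩
    ≡⟨ ⟨⟩-cong (stuffleW u v) (λ x → ι-cons c x n f) ⟩
  ⟨ u ⋆ v ∣ (λ x → Σ₂ n (λ l s → coefficient c l * ⟨ ιW x s ∣ f ∘ (c ℕ.+ l ∷_) ⟩)) ⟩
    ≡⟨ ⟨⟩-Σ₂ (stuffleW u v) n (λ l s x → coefficient c l * ⟨ ιW x s ∣ f ∘ (c ℕ.+ l ∷_) ⟩) ⟩
  Σ₂ n (λ l s → ⟨ u ⋆ v ∣ (λ x → coefficient c l * ⟨ ιW x s ∣ f ∘ (c ℕ.+ l ∷_) ⟩) ⟩)
    ≡⟨ Σ₂-cong n (λ l s → trans (⟨⟩-* (stuffleW u v) (coefficient c l) (λ x → ⟨ ιW x s ∣ f ∘ (c ℕ.+ l ∷_) ⟩))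
                                (cong (coefficient c l *_) (known s (f ∘ (c ℕ.+ l ∷_))))) ⟩
  Σ₂ n (λ l s → coefficient c l * ι⊗ι u v s (⋆-kernel (f ∘ (c ℕ.+ l ∷_)))) ∎

ι-⋆-step : ∀ a u b v n f →
  (∀ s g → ⟨ u ⋆ (b ∷ v) ∣ (λ x → ⟨ ιW x s ∣ g ⟩) ⟩ ≡ ι⊗ι u (b ∷ v) s (⋆-kernel g)) →
  (∀ s g → ⟨ (a ∷ u) ⋆ v ∣ (λ x → ⟨ ιW x s ∣ g ⟩) ⟩ ≡ ι⊗ι (a ∷ u) v s (⋆-kernel g)) →
  (∀ s g → ⟨ u ⋆ v ∣ (λ x → ⟨ ιW x s ∣ g ⟩) ⟩ ≡ ι⊗ι u v s (⋆-kernel g)) →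
  ⟨ (a ∷ u) ⋆ (b ∷ v) ∣ (λ x → ⟨ ιW x n ∣ f ⟩) ⟩ ≡ ι⊗ι (a ∷ u) (b ∷ v) n (⋆-kernel f)
ι-⋆-step a u b v n f ih₁ ih₂ ih₃ = begin
  ⟨ (a ∷ u) ⋆ (b ∷ v) ∣ (λ x → ⟨ ιW x n ∣ f ⟩) ⟩
    ≡⟨ ⋆-cons a u b v (λ x → ⟨ ιW x n ∣ f ⟩) ⟩
  ⟨ u ⋆ (b ∷ v) ∣ (λ x → ⟨ ιW (a ∷ x) n ∣ f ⟩) ⟩ + (⟨ (a ∷ u) ⋆ v ∣ (λ x → ⟨ ιW (b ∷ x) n ∣ f ⟩) ⟩
    + ⟨ u ⋆ v ∣ (λ x → ⟨ ιW (a ⊕ b ∷ x) n ∣ f ⟩) ⟩)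
    ≡⟨ cong₂ _+_ first (cong₂ _+_ second third) ⟩
  leadingLetters a b n X₁ + (leadingLetters a b n X₂ + leadingLetters a b n X₃)
    ≡⟨ trans (leadingLetters-+ a b n X₁ (λ l m s → X₂ l m s + X₃ l m s))
             (cong (leadingLetters a b n X₁ +_) (leadingLetters-+ a b n X₂ X₃)) ⟨
  leadingLetters a b n (λ l m s → X₁ l m s + (X₂ l m s + X₃ l m s))
    ≡⟨ leadingLetters-cong a b n split ⟨
  leadingLetters a b n (λ l m s → ι⊗ι u v s (λ x y → ⟨ (a ℕ.+ l ∷ x) ⋆ (b ℕ.+ m ∷ y) ∣ f ⟩))
    ≡⟨ ι⊗ι-cons a u b v n (⋆-kernel f) ⟨
  ι⊗ι (a ∷ u) (b ∷ v) n (⋆-kernel f) ∎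
  where
  -- the three terms of the stuffle recursion, after expanding both first letters
  X₁ X₂ X₃ : ℕ → ℕ → ℕ → ℚ
  X₁ l m s = ι⊗ι u v s (λ x y → ⟨ x ⋆ (b ℕ.+ m ∷ y) ∣ f ∘ (a ℕ.+ l ∷_) ⟩)
  X₂ l m s = ι⊗ι u v s (λ x y → ⟨ (a ℕ.+ l ∷ x) ⋆ y ∣ f ∘ (b ℕ.+ m ∷_) ⟩)
  X₃ l m s = ι⊗ι u v s (⋆-kernel (f ∘ ((a ⊕ b) ℕ.+ (l ℕ.+ m) ∷_)))

  split : ∀ l m s → ι⊗ι u v s (λ x y → ⟨ (a ℕ.+ l ∷ x) ⋆ (b ℕ.+ m ∷ y) ∣ f ⟩) ≡ X₁ l m s + (X₂ l m s + X₃ l m s)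
  split l m s =
    trans (ι⊗ι-cong u v s (λ x y → ⋆-cons (a ℕ.+ l) x (b ℕ.+ m) y f))
    (trans (ι⊗ι-+ u v s _ _)
    (cong (X₁ l m s +_) (trans (ι⊗ι-+ u v s _ _)
      (cong (X₂ l m s +_) (cong (λ c → ι⊗ι u v s (⋆-kernel (f ∘ (c ∷_)))) (mergedLetter a b l m))))))
    where
    mergedLetter : ∀ a b l m → suc ((a ℕ.+ l) ℕ.+ (b ℕ.+ m)) ≡ suc (a ℕ.+ b) ℕ.+ (l ℕ.+ m)
    mergedLetter = solve-∀-ℕ

  first : ⟨ u ⋆ (b ∷ v) ∣ (λ x → ⟨ ιW (a ∷ x) n ∣ f ⟩) ⟩ ≡ leadingLetters a b n X₁
  first = trans (ι-⋆-letter a u (b ∷ v) n f ih₁)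
                (Σ₂-cong n (λ l r → cong (coefficient a l *_) (ι⊗ι-consʳ b u v r (⋆-kernel (f ∘ (a ℕ.+ l ∷_))))))

  second : ⟨ (a ∷ u) ⋆ v ∣ (λ x → ⟨ ιW (b ∷ x) n ∣ f ⟩) ⟩ ≡ leadingLetters a b n X₂
  second =
    trans (ι-⋆-letter b (a ∷ u) v n f ih₂)
    (trans (Σ₂-cong n (λ m r → cong (coefficient b m *_) (ι⊗ι-consˡ a u v r (⋆-kernel (f ∘ (b ℕ.+ m ∷_))))))
           (sym (leadingLetters-exchange a b n X₂)))

  third : ⟨ u ⋆ v ∣ (λ x → ⟨ ιW (a ⊕ b ∷ x) n ∣ f ⟩) ⟩ ≡ leadingLetters a b n X₃
  third = trans (ι-⋆-letter (a ⊕ b) u v n f ih₃)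
                (sym (leadingLetters-merge a b n (λ q s → ι⊗ι u v s (⋆-kernel (f ∘ ((a ⊕ b) ℕ.+ q ∷_))))))

-- Statement (ii) on words: the coefficient of T^n in ι(u ⋆ v) equals that of ι u ∗ₜ ι v.
ι-⋆ : ∀ u v n f → ⟨ u ⋆ v ∣ (λ x → ⟨ ιW x n ∣ f ⟩) ⟩ ≡ ι⊗ι u v n (⋆-kernel f)
ι-⋆ [] v n f =
  trans (⋆-nilˡ v (λ x → ⟨ ιW x n ∣ f ⟩))
        (sym (trans (ι⊗ι-nilˡ v n (⋆-kernel f)) (⟨⟩-cong (ιW v n) (λ y → ⋆-nilˡ y f))))
ι-⋆ (a ∷ u) [] n f =
  trans (⋆-nilʳ (a ∷ u) (λ x → ⟨ ιW x n ∣ f ⟩))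
        (sym (trans (ι⊗ι-nilʳ (a ∷ u) n (⋆-kernel f)) (⟨⟩-cong (ιW (a ∷ u) n) (λ x → ⋆-nilʳ x f))))
ι-⋆ (a ∷ u) (b ∷ v) n f = ι-⋆-step a u b v n f (ι-⋆ u (b ∷ v)) (ι-⋆ (a ∷ u) v) (ι-⋆ u v)

⟨⟩-ι : ∀ p n f → ⟨ ι p n ∣ f ⟩ ≡ ⟨ p ∣ (λ x → ⟨ ιW x n ∣ f ⟩) ⟩
⟨⟩-ι p n f = ⟨⟩-linearExtension _ (λ x → ⟨ ιW x n ∣ f ⟩) p f (λ c w → ⟨⟩-scale c (ιW w n) f)

⟨⟩-∗ₜ : ∀ (F G : HT) n f → ⟨ (F ∗ₜ G) n ∣ f ⟩ ≡ Σ₂ n (λ i j → ⟨ F i ∗ G j ∣ f ⟩)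
⟨⟩-∗ₜ F G n f = ⟨⟩-concatMap-upTo (λ i → F i ∗ G (n ℕ.∸ i)) (suc n) f

⟨⟩-ι∗ₜι : ∀ p q n f → ⟨ (ι p ∗ₜ ι q) n ∣ f ⟩ ≡ ⟨ p ∣ (λ u → ⟨ q ∣ (λ v → ι⊗ι u v n (⋆-kernel f)) ⟩) ⟩
⟨⟩-ι∗ₜι p q n f = begin
  ⟨ (ι p ∗ₜ ι q) n ∣ f ⟩
    ≡⟨ ⟨⟩-∗ₜ (ι p) (ι q) n f ⟩
  Σ₂ n (λ i j → ⟨ ι p i ∗ ι q j ∣ f ⟩)
    ≡⟨ Σ₂-cong n (λ i j → trans (⟨⟩-∗ (ι p i) (ι q j) f) (trans (⟨⟩-ι p i _) (⟨⟩-cong p (λ u → ⟨⟩-cong (ιW u i) (λ x → ⟨⟩-ι q j _))))) ⟩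
  Σ₂ n (λ i j → ⟨ p ∣ (λ u → ⟨ ιW u i ∣ (λ x → ⟨ q ∣ (λ v → ⟨ ιW v j ∣ ⋆-kernel f x ⟩) ⟩) ⟩) ⟩)
    ≡⟨ Σ₂-cong n (λ i j → ⟨⟩-cong p (λ u → ⟨⟩-swap (ιW u i) q (λ x v → ⟨ ιW v j ∣ ⋆-kernel f x ⟩))) ⟩
  Σ₂ n (λ i j → ⟨ p ∣ (λ u → ⟨ q ∣ (λ v → ⟨ ιW u i ∣ (λ x → ⟨ ιW v j ∣ ⋆-kernel f x ⟩) ⟩) ⟩) ⟩)
    ≡⟨ ⟨⟩-Σ₂ p n (λ i j u → ⟨ q ∣ (λ v → ⟨ ιW u i ∣ (λ x → ⟨ ιW v j ∣ ⋆-kernel f x ⟩) ⟩) ⟩) ⟨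
  ⟨ p ∣ (λ u → Σ₂ n (λ i j → ⟨ q ∣ (λ v → ⟨ ιW u i ∣ (λ x → ⟨ ιW v j ∣ ⋆-kernel f x ⟩) ⟩) ⟩)) ⟩
    ≡⟨ ⟨⟩-cong p (λ u → ⟨⟩-Σ₂ q n (λ i j v → ⟨ ιW u i ∣ (λ x → ⟨ ιW v j ∣ ⋆-kernel f x ⟩) ⟩)) ⟨
  ⟨ p ∣ (λ u → ⟨ q ∣ (λ v → ι⊗ι u v n (⋆-kernel f)) ⟩) ⟩ ∎

ι-morphism : (u v : H) → ι (u ∗ v) ≈ᵀ ι u ∗ₜ ι v
ι-morphism p q n = ≈ᴴ-byPairing (ι (p ∗ q) n) ((ι p ∗ₜ ι q) n) λ f → begin
  ⟨ ι (p ∗ q) n ∣ f ⟩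
    ≡⟨ trans (⟨⟩-ι (p ∗ q) n f) (⟨⟩-∗ p q _) ⟩
  ⟨ p ∣ (λ u → ⟨ q ∣ (λ v → ⟨ u ⋆ v ∣ (λ x → ⟨ ιW x n ∣ f ⟩) ⟩) ⟩) ⟩
    ≡⟨ ⟨⟩-cong p (λ u → ⟨⟩-cong q (λ v → ι-⋆ u v n f)) ⟩
  ⟨ p ∣ (λ u → ⟨ q ∣ (λ v → ι⊗ι u v n (⋆-kernel f)) ⟩) ⟩
    ≡⟨ ⟨⟩-ι∗ₜι p q n f ⟨
  ⟨ (ι p ∗ₜ ι q) n ∣ f ⟩ ∎

lemma3p1 : ((u v : H) → inv (u ∗ v) ≈ᴴ inv v ∗ inv u)
         × ((u v : H) → ι (u ∗ v) ≈ᵀ ι u ∗ₜ ι v)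
lemma3p1 = inv-antimorphism , ι-morphism
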